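{- For any $3$-graph $F$ and any vertex $v\in V(F)$, $F$ is layered if and only if $F_v$ is layered.
   Context: A $3$-graph is a $3$-uniform hypergraph. $F$ is layered if there is $f:V(F)\to\mathbb{N}$ such that: (A1) in each edge exactly one vertex has label strictly greater than the other two; (A2) if two edges have the same maximum label, their multisets of labels are equal; (A3) if two edges $uvw$, $u'v'w'$ satisfy $f(u)=f(u')$ and $f(v)=f(v')$, then $f(w)=f(w')$. The link graph $L_F(v)$ is the graph on $V(F)\setminus\{v\}$ with edges $\{uw: uvw\in E(F)\}$. The $3$-graph $F_v$ is obtained from $F$ as follows: delete $v$, and for each $uw\in L_F(v)$ add a new vertex $v_{uw}$ and the edge $uwv_{uw}$; then add three new vertices $x_v,y_v,z_v$, and for each $uw\in L_F(v)$ add three further new vertices $x_{uw},y_{uw},z_{uw}$ and the six edges $x_vv_{uw}x_{uw}$, $x_vy_{uw}z_{uw}$, $y_vv_{uw}y_{uw}$, $y_vx_{uw}z_{uw}$, $z_vv_{uw}z_{uw}$, $z_vx_{uw}y_{uw}$ (a Fano plane on $\{x_v,y_v,z_v,v_{uw},x_{uw},y_{uw},z_{uw}\}$ minus the edge $x_vy_vz_v$). -}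

module Defs where

open import Data.Nat using (ℕ; _<_; _⊔_)
open import Data.Fin using (Fin; zero; suc)
import Data.Fin as F
open import Data.Bool using (Bool; T)
open import Data.List using (List; _∷_; [])
open import Data.List.Relation.Binary.Permutation.Propositional using (_↭_)
open import Data.Product using (Σ; _×_; ∃)
open import Relation.Binary.PropositionalEquality using (_≡_; _≢_)

-- The edge set is given by a
-- decidable (Boolean) predicate on triples which is invariant under all
-- permutations (generated by two transpositions) and only holds on triples
-- of pairwise distinct vertices; E a b c = true means {a,b,c} is an edge.
record ThreeGraph : Set where
  field
    n       : ℕ
    E       : Fin n → Fin n → Fin n → Bool
    swap₁₂  : ∀ a b c → E a b c ≡ E b a c
    swap₂₃  : ∀ a b c → E a b c ≡ E a c b
    distinct : ∀ a b c → T (E a b c) → a ≢ b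

open ThreeGraph public

Edge : (G : ThreeGraph) → Fin (n G) → Fin (n G) → Fin (n G) → Set
Edge G a b c = T (E G a b c)

lab3 : ℕ → ℕ → ℕ → Fin 3 → ℕ
lab3 a b c zero = a
lab3 a b c (suc zero) = b
lab3 a b c (suc (suc zero)) = c

StrictMaxAt : ℕ → ℕ → ℕ → Fin 3 → Set
StrictMaxAt a b c i = ∀ j → j ≢ i → lab3 a b c j < lab3 a b c i

ExactlyOneStrictMax : ℕ → ℕ → ℕ → Set
ExactlyOneStrictMax a b c =
  Σ (Fin 3) λ i → StrictMaxAt a b c i × (∀ j → StrictMaxAt a b c j → j ≡ i)

Layered : (V : Set) → (V → V → V → Set) → Set
Layered V Ed = Σ (V → ℕ) λ f →
    (∀ x y z → Ed x y z → ExactlyOneStrictMax (f x) (f y) (f z))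
  × (∀ x y z x' y' z' → Ed x y z → Ed x' y' z' →
       f x ⊔ f y ⊔ f z ≡ f x' ⊔ f y' ⊔ f z' →
       (f x ∷ f y ∷ f z ∷ []) ↭ (f x' ∷ f y' ∷ f z' ∷ []))
  × (∀ u v w u' v' w' → Ed u v w → Ed u' v' w' →
       f u ≡ f u' → f v ≡ f v' → f w ≡ f w')

-- Old vertices u ≠ v; for each link edge uw of v
-- (represented by u < w with {v,u,w} ∈ E) the vertices v_uw, x_uw, y_uw, z_uw;
-- and x_v, y_v, z_v. Proof fields are irrelevant, so each vertex occurs once.
data Vtx (G : ThreeGraph) (v : Fin (n G)) : Set where
  old : (u : Fin (n G)) → .(u ≢ v) → Vtx G v
  vn xn yn zn : (u w : Fin (n G)) → .(u F.< w) → .(T (E G v u w)) → Vtx G v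
  xv yv zv : Vtx G v

data BaseEdge (G : ThreeGraph) (v : Fin (n G)) : Vtx G v → Vtx G v → Vtx G v → Set where
  oldE : ∀ a b c .{pa : a ≢ v} .{pb : b ≢ v} .{pc : c ≢ v} → T (E G a b c) →
         BaseEdge G v (old a pa) (old b pb) (old c pc)
  linkE : ∀ u w .{pu : u ≢ v} .{pw : w ≢ v} .{l : u F.< w} .{e : T (E G v u w)} →
          BaseEdge G v (old u pu) (old w pw) (vn u w l e)
  g₁ : ∀ u w .{l : u F.< w} .{e : T (E G v u w)} → BaseEdge G v xv (vn u w l e) (xn u w l e)
  g₂ : ∀ u w .{l : u F.< w} .{e : T (E G v u w)} → BaseEdge G v xv (yn u w l e) (zn u w l e)
  g₃ : ∀ u w .{l : u F.< w} .{e : T (E G v u w)} → BaseEdge G v yv (vn u w l e) (yn u w l e)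
  g₄ : ∀ u w .{l : u F.< w} .{e : T (E G v u w)} → BaseEdge G v yv (xn u w l e) (zn u w l e)
  g₅ : ∀ u w .{l : u F.< w} .{e : T (E G v u w)} → BaseEdge G v zv (vn u w l e) (zn u w l e)
  g₆ : ∀ u w .{l : u F.< w} .{e : T (E G v u w)} → BaseEdge G v zv (xn u w l e) (yn u w l e)

EdgeFv : (G : ThreeGraph) (v : Fin (n G)) → Vtx G v → Vtx G v → Vtx G v → Set
EdgeFv G v x y z = ∃ λ a → ∃ λ b → ∃ λ c →
  BaseEdge G v a b c × ((a ∷ b ∷ c ∷ []) ↭ (x ∷ y ∷ z ∷ []))

-- Both directions compare sets of label triples. Given a layering f of F,
-- label F_v by f on old vertices, by f(v) on every v_uw, x_uw, y_uw, z_uw,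
-- and by a common L on x_v, y_v, z_v: the new edges then carry a permutation
-- of (f(v), f(v), L). If F already has an edge labelled (f(v), f(v), r),
-- take L = r; otherwise take L above every label, and the new triples cannot
-- collide with the old ones. Conversely, in a layered Fano plane minus a line
-- the four points off the line get equal labels (look at where the largest
-- label sits), so v_uw and x_uw share a label and x_v v_uw x_uw is labelled
-- (L, c, c); hence all v_uw get the same c, which is a valid label for v.
module Submission where

open import Defs
open import Data.Bool using (T)
open import Data.Bool.Properties using (T?)
open import Data.Empty using (⊥; ⊥-elim)
open import Data.Fin using (Fin; zero; suc)
import Data.Fin as F
import Data.Fin.Properties as FP
open import Data.List using (_∷_; []; tabulate)
open import Data.List.Extrema.Nat using (max; argmax-sel; ⊥≤max; xs≤max)
open import Data.List.Membership.Propositional using (_∈_)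
open import Data.List.Membership.Propositional.Properties using (∈-tabulate⁺)
open import Data.List.Relation.Binary.Permutation.Propositional
  using (_↭_; prep; swap; ↭-refl; ↭-sym; ↭-trans)
open import Data.List.Relation.Binary.Permutation.Propositional.Properties
  using (∈-resp-↭; ↭-singleton-inv; drop-mid; map⁺)
open import Data.List.Relation.Unary.All as All using (All; _∷_; [])
open import Data.List.Relation.Unary.Any using (here; there)
open import Data.Nat using (ℕ; suc; _≤_; _<_; _⊔_; s≤s)
open import Data.Nat.Properties
open import Data.Product using (_×_; ∃; _,_; proj₁; proj₂)
open import Data.Sum as Sum using (_⊎_; inj₁; inj₂; [_,_]′)
open import Function using (id; _∘_)
open import Function.Bundles using (_⇔_; mk⇔)
open import Relation.Binary.Definitions using (tri<; tri≈; tri>)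
open import Relation.Binary.PropositionalEquality
open import Relation.Nullary using (¬_; Dec; yes; no; contradiction)
open import Relation.Nullary.Decidable using (_×-dec_; recompute)

↭-pair-inv : ∀ {A : Set} {a b p q : A} → (a ∷ b ∷ []) ↭ (p ∷ q ∷ []) →
             (a ≡ p × b ≡ q) ⊎ (a ≡ q × b ≡ p)
↭-pair-inv {p = p} σ with ∈-resp-↭ σ (here refl)
... | here refl with refl ← ↭-singleton-inv (drop-mid [] [] σ) = inj₁ (refl , refl)
... | there (here refl) with refl ← ↭-singleton-inv (drop-mid [] (p ∷ []) σ) = inj₂ (refl , refl)

Rel₃ : Set → Set₁
Rel₃ A = A → A → A → Set

_∪₃_ : ∀ {A : Set} → Rel₃ A → Rel₃ A → Rel₃ A
(R ∪₃ R′) a b c = R a b c ⊎ R′ a b c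

record Symmetric3 {A : Set} (R : Rel₃ A) : Set where
  field
    exchange₁₂ : ∀ {a b c} → R a b c → R b a c
    exchange₂₃ : ∀ {a b c} → R a b c → R a c b

module _ {A : Set} {R : Rel₃ A} (sym₃ : Symmetric3 R) where
  open Symmetric3 sym₃

  resp-↭ : ∀ {a b c p q r} → (a ∷ b ∷ c ∷ []) ↭ (p ∷ q ∷ r ∷ []) → R a b c → R p q r
  resp-↭ {p = p} {q} σ s with ∈-resp-↭ σ (here refl)
  ... | here refl with ↭-pair-inv (drop-mid [] [] σ)
  ...   | inj₁ (refl , refl) = s
  ...   | inj₂ (refl , refl) = exchange₂₃ s
  resp-↭ {p = p} {q} σ s | there (here refl) with ↭-pair-inv (drop-mid [] (p ∷ []) σ)
  ...   | inj₁ (refl , refl) = exchange₁₂ s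
  ...   | inj₂ (refl , refl) = exchange₁₂ (exchange₂₃ s)
  resp-↭ {p = p} {q} σ s | there (there (here refl)) with ↭-pair-inv (drop-mid [] (p ∷ q ∷ []) σ)
  ...   | inj₁ (refl , refl) = exchange₂₃ (exchange₁₂ s)
  ...   | inj₂ (refl , refl) = exchange₂₃ (exchange₁₂ (exchange₂₃ s))

maximum-attained : ∀ x xs → ∃ λ m → m ∈ x ∷ xs × All (_≤ m) (x ∷ xs)
maximum-attained x xs =
  max x xs , [ here , there ]′ (argmax-sel id x xs) , ⊥≤max x xs ∷ xs≤max x xs

strictMax⇒exactlyOne : ∀ {a b c i} → StrictMaxAt a b c i → ExactlyOneStrictMax a b c
strictMax⇒exactlyOne {i = i} max-i = i , max-i , unique
  where
  unique : ∀ j → StrictMaxAt _ _ _ j → j ≡ i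
  unique j max-j with j F.≟ i
  ... | yes j≡i = j≡i
  ... | no j≢i = ⊥-elim (<-asym (max-i j j≢i) (max-j i (λ i≡j → j≢i (sym i≡j))))

oneMax₀ : ∀ {a b c} → b < a → c < a → ExactlyOneStrictMax a b c
oneMax₀ b<a c<a = strictMax⇒exactlyOne λ
  { zero j≢i → contradiction refl j≢i ; (suc zero) _ → b<a ; (suc (suc zero)) _ → c<a }

oneMax₁ : ∀ {a b c} → a < b → c < b → ExactlyOneStrictMax a b c
oneMax₁ a<b c<b = strictMax⇒exactlyOne λ
  { zero _ → a<b ; (suc zero) j≢i → contradiction refl j≢i ; (suc (suc zero)) _ → c<b }

oneMax₂ : ∀ {a b c} → a < c → b < c → ExactlyOneStrictMax a b c
oneMax₂ a<c b<c = strictMax⇒exactlyOne λ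
  { zero _ → a<c ; (suc zero) _ → b<c ; (suc (suc zero)) j≢i → contradiction refl j≢i }

oneMax-atTop : ∀ {a b c} → ExactlyOneStrictMax a b c → b ≤ a → c ≤ a → b < a × c < a
oneMax-atTop (zero , max₀ , _) _ _ = max₀ (suc zero) (λ ()) , max₀ (suc (suc zero)) (λ ())
oneMax-atTop (suc zero , max₁ , _) b≤a _ = contradiction b≤a (<⇒≱ (max₁ zero (λ ())))
oneMax-atTop (suc (suc zero) , max₂ , _) _ c≤a = contradiction c≤a (<⇒≱ (max₂ zero (λ ())))

oneMax-doubled : ∀ {a b} → ExactlyOneStrictMax a b b → b < a
oneMax-doubled (zero , max₀ , _) = max₀ (suc zero) (λ ())
oneMax-doubled (suc zero , max₁ , _) = ⊥-elim (<-irrefl refl (max₁ (suc (suc zero)) (λ ())))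
oneMax-doubled (suc (suc zero) , max₂ , _) = ⊥-elim (<-irrefl refl (max₂ (suc zero) (λ ())))

max-of-top : ∀ {a b c} → b < a → c < a → a ⊔ b ⊔ c ≡ a
max-of-top b<a c<a =
  trans (cong (_⊔ _) (m≥n⇒m⊔n≡m (<⇒≤ b<a))) (m≥n⇒m⊔n≡m (<⇒≤ c<a))

-- Layered sets of label triples

Triples : Set₁
Triples = Rel₃ ℕ

_⊆₃_ : Triples → Triples → Set
S ⊆₃ S′ = ∀ {a b c} → S a b c → S′ a b c

record LayeredTriples (S : Triples) : Set where
  field
    oneMax     : ∀ {a b c} → S a b c → ExactlyOneStrictMax a b c
    sameMax⇒↭ : ∀ {a b c a′ b′ c′} → S a b c → S a′ b′ c′ → a ⊔ b ⊔ c ≡ a′ ⊔ b′ ⊔ c′ →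
                 (a ∷ b ∷ c ∷ []) ↭ (a′ ∷ b′ ∷ c′ ∷ [])
    functional : ∀ {a b c c′} → S a b c → S a b c′ → c ≡ c′

open LayeredTriples

antimono : ∀ {S S′} → S ⊆₃ S′ → LayeredTriples S′ → LayeredTriples S
antimono S⊆S′ L = record
  { oneMax     = λ s → oneMax L (S⊆S′ s)
  ; sameMax⇒↭ = λ s s′ → sameMax⇒↭ L (S⊆S′ s) (S⊆S′ s′)
  ; functional = λ s s′ → functional L (S⊆S′ s) (S⊆S′ s′)
  }

∪-layered : ∀ {S S′} → LayeredTriples S → LayeredTriples S′ →
            (∀ {a b c a′ b′ c′} → S a b c → S′ a′ b′ c′ → a ⊔ b ⊔ c ≢ a′ ⊔ b′ ⊔ c′) →
            (∀ {a b c c′} → S a b c → S′ a b c′ → ⊥) →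
            LayeredTriples (S ∪₃ S′)
∪-layered LS LS′ maxes-differ no-common-pair = record
  { oneMax     = [ oneMax LS , oneMax LS′ ]′
  ; sameMax⇒↭ = λ
      { (inj₁ s) (inj₁ t) eq → sameMax⇒↭ LS s t eq
      ; (inj₁ s) (inj₂ t) eq → contradiction eq (maxes-differ s t)
      ; (inj₂ s) (inj₁ t) eq → contradiction (sym eq) (maxes-differ t s)
      ; (inj₂ s) (inj₂ t) eq → sameMax⇒↭ LS′ s t eq }
  ; functional = λ
      { (inj₁ s) (inj₁ t) → functional LS s t
      ; (inj₁ s) (inj₂ t) → ⊥-elim (no-common-pair s t)
      ; (inj₂ s) (inj₁ t) → ⊥-elim (no-common-pair t s)
      ; (inj₂ s) (inj₂ t) → functional LS′ s t }
  }

∪-symmetric : ∀ {A : Set} {R R′ : Rel₃ A} → Symmetric3 R → Symmetric3 R′ → Symmetric3 (R ∪₃ R′)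
∪-symmetric sym sym′ = record
  { exchange₁₂ = Sum.map (exchange₁₂ sym) (exchange₁₂ sym′)
  ; exchange₂₃ = Sum.map (exchange₂₃ sym) (exchange₂₃ sym′) }
  where open Symmetric3

labels : {V : Set} → Rel₃ V → (V → ℕ) → Triples
labels Ed f a b c = ∃ λ x → ∃ λ y → ∃ λ z → Ed x y z × f x ≡ a × f y ≡ b × f z ≡ c

labels-symmetric : ∀ {V : Set} {Ed : Rel₃ V} {f} →
                   Symmetric3 Ed → Symmetric3 (labels Ed f)
labels-symmetric sym₃ = record
  { exchange₁₂ = λ (x , y , z , e , p , q , r) → y , x , z , exchange₁₂ e , q , p , r
  ; exchange₂₃ = λ (x , y , z , e , p , q , r) → x , z , y , exchange₂₃ e , p , r , q }
  where open Symmetric3 sym₃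

layered⇒layeredLabels : ∀ {V : Set} {Ed : Rel₃ V} →
                        Layered V Ed → ∃ λ f → LayeredTriples (labels Ed f)
layered⇒layeredLabels (f , A1 , A2 , A3) = f , record
  { oneMax     = λ { (x , y , z , e , refl , refl , refl) → A1 x y z e }
  ; sameMax⇒↭ = λ { (x , y , z , e , refl , refl , refl) (x′ , y′ , z′ , e′ , refl , refl , refl) →
                     A2 x y z x′ y′ z′ e e′ }
  ; functional = λ { (x , y , z , e , refl , refl , refl) (x′ , y′ , z′ , e′ , p , q , refl) →
                     A3 x y z x′ y′ z′ e e′ (sym p) (sym q) } }

layeredLabels⇒layered : ∀ {V : Set} {Ed : Rel₃ V} →
                        (∃ λ f → LayeredTriples (labels Ed f)) → Layered V Ed
layeredLabels⇒layered (f , L) = f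
  , (λ x y z e → oneMax L (x , y , z , e , refl , refl , refl))
  , (λ x y z x′ y′ z′ e e′ → sameMax⇒↭ L (x , y , z , e , refl , refl , refl)
                                         (x′ , y′ , z′ , e′ , refl , refl , refl))
  , (λ u v w u′ v′ w′ e e′ p q → functional L (u , v , w , e , refl , refl , refl)
                                              (u′ , v′ , w′ , e′ , sym p , sym q , refl))

-- A layered Fano plane minus a line

module FanoMinusLine {S : Triples} (LS : LayeredTriples S) (sym₃ : Symmetric3 S) where
  open Symmetric3 sym₃

  doubled-unique : ∀ {o a b} → S o a a → S o b b → a ≡ b
  doubled-unique s t
    with a<o ← oneMax-doubled (oneMax LS s) | b<o ← oneMax-doubled (oneMax LS t)
    with ∈-resp-↭ (sameMax⇒↭ LS s t (trans (max-of-top a<o a<o) (sym (max-of-top b<o b<o))))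
                  (there (here refl))
  ... | here refl = ⊥-elim (<-irrefl refl a<o)
  ... | there (here a≡b) = a≡b
  ... | there (there (here a≡b)) = a≡b

  -- X, Y, Z are the points of the missing line (x_v, y_v, z_v in F_v) and
  -- V, x, y, z the other four (v_uw, x_uw, y_uw, z_uw).
  Fano : (X Y Z V x y z : ℕ) → Set
  Fano X Y Z V x y z = S X V x × S X y z × S Y V y × S Y x z × S Z V z × S Z x y

  swapXY : ∀ {X Y Z V x y z} → Fano X Y Z V x y z → Fano Y X Z V y x z
  swapXY (e₁ , e₂ , e₃ , e₄ , e₅ , e₆) = e₃ , e₄ , e₁ , e₂ , e₅ , exchange₂₃ e₆

  swapXZ : ∀ {X Y Z V x y z} → Fano X Y Z V x y z → Fano Z Y X V z y x
  swapXZ (e₁ , e₂ , e₃ , e₄ , e₅ , e₆) =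
    e₅ , exchange₂₃ e₆ , e₃ , exchange₂₃ e₄ , e₁ , exchange₂₃ e₂

  swapVx : ∀ {X Y Z V x y z} → Fano X Y Z V x y z → Fano X Y Z x V z y
  swapVx (e₁ , e₂ , e₃ , e₄ , e₅ , e₆) =
    exchange₂₃ e₁ , exchange₂₃ e₂ , e₄ , e₃ , e₆ , e₅

  swapVy : ∀ {X Y Z V x y z} → Fano X Y Z V x y z → Fano X Y Z y z V x
  swapVy (e₁ , e₂ , e₃ , e₄ , e₅ , e₆) =
    e₂ , e₁ , exchange₂₃ e₃ , exchange₂₃ e₄ , exchange₂₃ e₆ , exchange₂₃ e₅

  -- X V x and X y z peak at X, so y ∈ {V, x}; then z is the other one, and
  -- Y V y, Y x z (or Z V z, Z x y) have doubled bases, which forces V = x.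
  top-on-line : ∀ {X Y Z V x y z} → V ≤ X → x ≤ X → y ≤ X → z ≤ X →
                Fano X Y Z V x y z → V ≡ x × V ≡ y × V ≡ z
  top-on-line V≤X x≤X y≤X z≤X (e₁ , e₂ , e₃ , e₄ , e₅ , e₆)
    with V<X , x<X ← oneMax-atTop (oneMax LS e₁) V≤X x≤X
       | y<X , z<X ← oneMax-atTop (oneMax LS e₂) y≤X z≤X
    with ∈-resp-↭ (sameMax⇒↭ LS e₂ e₁ (trans (max-of-top y<X z<X) (sym (max-of-top V<X x<X))))
                  (there (here refl))
  ... | here refl = ⊥-elim (<-irrefl refl y<X)
  ... | there (here refl) with refl ← functional LS e₂ e₁ with refl ← doubled-unique e₃ e₄ =
    refl , refl , refl
  ... | there (there (here refl)) with refl ← functional LS e₂ (exchange₂₃ e₁)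
                                  with refl ← doubled-unique e₅ e₆ = refl , refl , refl

  -- The lines through V all peak at V, so y, z ∈ {X, x}; each choice breaks X y z.
  top-not-off-line : ∀ {X Y Z V x y z} → X ≤ V → x ≤ V → Y ≤ V → y ≤ V → Z ≤ V → z ≤ V →
                     ¬ Fano X Y Z V x y z
  top-not-off-line X≤V x≤V Y≤V y≤V Z≤V z≤V (e₁ , e₂ , e₃ , e₄ , e₅ , e₆)
    with X<V , x<V ← oneMax-atTop (oneMax LS (exchange₁₂ e₁)) X≤V x≤V
       | Y<V , y<V ← oneMax-atTop (oneMax LS (exchange₁₂ e₃)) Y≤V y≤V
       | Z<V , z<V ← oneMax-atTop (oneMax LS (exchange₁₂ e₅)) Z≤V z≤V
    with ∈-resp-↭ (sameMax⇒↭ LS (exchange₁₂ e₃) (exchange₁₂ e₁) (max≡ Y<V y<V X<V x<V))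
                  (there (there (here refl)))
       | ∈-resp-↭ (sameMax⇒↭ LS (exchange₁₂ e₅) (exchange₁₂ e₁) (max≡ Z<V z<V X<V x<V))
                  (there (there (here refl)))
    where
    max≡ : ∀ {V a b c d} → a < V → b < V → c < V → d < V → V ⊔ a ⊔ b ≡ V ⊔ c ⊔ d
    max≡ a<V b<V c<V d<V = trans (max-of-top a<V b<V) (sym (max-of-top c<V d<V))
  ... | here refl | _ = <-irrefl refl y<V
  ... | _ | here refl = <-irrefl refl z<V
  ... | there (there (here refl)) | _ with refl ← functional LS e₂ (exchange₂₃ e₁) = <-irrefl refl z<V
  ... | there (here refl) | there (there (here refl))
    with refl ← functional LS (exchange₂₃ e₂) (exchange₂₃ e₁) = <-irrefl refl y<V
  ... | there (here refl) | there (here refl) = <-irrefl refl (oneMax-doubled (oneMax LS e₂))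

  fano-at-max : ∀ {X Y Z V x y z m} → m ∈ X ∷ Y ∷ Z ∷ V ∷ x ∷ y ∷ z ∷ [] →
                All (_≤ m) (X ∷ Y ∷ Z ∷ V ∷ x ∷ y ∷ z ∷ []) →
                Fano X Y Z V x y z → V ≡ x × V ≡ y × V ≡ z
  fano-at-max (here refl) (_ ∷ _ ∷ _ ∷ V≤ ∷ x≤ ∷ y≤ ∷ z≤ ∷ []) es =
    top-on-line V≤ x≤ y≤ z≤ es
  fano-at-max (there (here refl)) (_ ∷ _ ∷ _ ∷ V≤ ∷ x≤ ∷ y≤ ∷ z≤ ∷ []) es
    with V≡y , V≡x , V≡z ← top-on-line V≤ y≤ x≤ z≤ (swapXY es) = V≡x , V≡y , V≡z
  fano-at-max (there (there (here refl))) (_ ∷ _ ∷ _ ∷ V≤ ∷ x≤ ∷ y≤ ∷ z≤ ∷ []) es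
    with V≡z , V≡y , V≡x ← top-on-line V≤ z≤ y≤ x≤ (swapXZ es) = V≡x , V≡y , V≡z
  fano-at-max (there (there (there (here refl))))
              (X≤ ∷ Y≤ ∷ Z≤ ∷ _ ∷ x≤ ∷ y≤ ∷ z≤ ∷ []) es =
    ⊥-elim (top-not-off-line X≤ x≤ Y≤ y≤ Z≤ z≤ es)
  fano-at-max (there (there (there (there (here refl)))))
              (X≤ ∷ Y≤ ∷ Z≤ ∷ V≤ ∷ _ ∷ y≤ ∷ z≤ ∷ []) es =
    ⊥-elim (top-not-off-line X≤ V≤ Y≤ z≤ Z≤ y≤ (swapVx es))
  fano-at-max (there (there (there (there (there (here refl))))))
              (X≤ ∷ Y≤ ∷ Z≤ ∷ V≤ ∷ x≤ ∷ _ ∷ z≤ ∷ []) es =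
    ⊥-elim (top-not-off-line X≤ z≤ Y≤ V≤ Z≤ x≤ (swapVy es))
  fano-at-max (there (there (there (there (there (there (here refl)))))))
              (X≤ ∷ Y≤ ∷ Z≤ ∷ V≤ ∷ x≤ ∷ y≤ ∷ _ ∷ []) es =
    ⊥-elim (top-not-off-line X≤ y≤ Y≤ x≤ Z≤ V≤ (swapVy (swapVx es)))

  fano : ∀ {X Y Z V x y z} → Fano X Y Z V x y z → V ≡ x × V ≡ y × V ≡ z
  fano {X} {Y} {Z} {V} {x} {y} {z} es =
    let _ , m∈ , bounds = maximum-attained X (Y ∷ Z ∷ V ∷ x ∷ y ∷ z ∷ []) in fano-at-max m∈ bounds es

-- The triples labelling the Fano edges of F_v

data Doubled (a L : ℕ) : Triples where
  apex₁ : Doubled a L L a a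
  apex₂ : Doubled a L a L a
  apex₃ : Doubled a L a a L

doubled-symmetric : ∀ {a L} → Symmetric3 (Doubled a L)
doubled-symmetric = record
  { exchange₁₂ = λ { apex₁ → apex₂ ; apex₂ → apex₁ ; apex₃ → apex₃ }
  ; exchange₂₃ = λ { apex₁ → apex₁ ; apex₂ → apex₃ ; apex₃ → apex₂ } }

doubled-↭ : ∀ {a L p q r} → Doubled a L p q r → (a ∷ a ∷ L ∷ []) ↭ (p ∷ q ∷ r ∷ [])
doubled-↭ {a} {L} apex₁ = ↭-trans (prep a (swap a L ↭-refl)) (swap a L ↭-refl)
doubled-↭ {a} {L} apex₂ = prep a (swap a L ↭-refl)
doubled-↭ apex₃ = ↭-refl

doubled-⊆ : ∀ {R a L} → Symmetric3 R → R a a L → Doubled a L ⊆₃ R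
doubled-⊆ sym₃ r d = resp-↭ sym₃ (doubled-↭ d) r

doubled-max : ∀ {a L p q r} → Doubled a L p q r → L ≤ p ⊔ q ⊔ r
doubled-max {a} {L} apex₁ = ≤-trans (m≤m⊔n L a) (m≤m⊔n (L ⊔ a) a)
doubled-max {a} {L} apex₂ = ≤-trans (m≤n⊔m a L) (m≤m⊔n (a ⊔ L) a)
doubled-max {a} {L} apex₃ = m≤n⊔m (a ⊔ a) L

doubled-layered : ∀ {a L} → a < L → LayeredTriples (Doubled a L)
doubled-layered a<L = record
  { oneMax     = λ { apex₁ → oneMax₀ a<L a<L ; apex₂ → oneMax₁ a<L a<L ; apex₃ → oneMax₂ a<L a<L }
  ; sameMax⇒↭ = λ d d′ _ → ↭-trans (↭-sym (doubled-↭ d)) (doubled-↭ d′)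
  ; functional = λ { apex₁ apex₁ → refl ; apex₁ apex₂ → refl ; apex₁ apex₃ → refl
                   ; apex₂ apex₁ → refl ; apex₂ apex₂ → refl ; apex₂ apex₃ → refl
                   ; apex₃ apex₁ → refl ; apex₃ apex₂ → refl ; apex₃ apex₃ → refl } }

edge-symmetric : (G : ThreeGraph) → Symmetric3 (Edge G)
edge-symmetric G = record
  { exchange₁₂ = λ {a b c} → subst T (swap₁₂ G a b c)
  ; exchange₂₃ = λ {a b c} → subst T (swap₂₃ G a b c) }

edgeFv-symmetric : (G : ThreeGraph) (v : Fin (n G)) → Symmetric3 (EdgeFv G v)
edgeFv-symmetric G v = record
  { exchange₁₂ = λ (a , b , c , e , σ) → a , b , c , e , ↭-trans σ (swap _ _ ↭-refl)
  ; exchange₂₃ = λ (a , b , c , e , σ) → a , b , c , e , ↭-trans σ (prep _ (swap _ _ ↭-refl)) }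

module Forward (G : ThreeGraph) (v : Fin (n G)) {f : Fin (n G) → ℕ}
               (LF : LayeredTriples (labels (Edge G) f)) where
  open Symmetric3 (edge-symmetric G)

  P : Triples
  P = labels (Edge G) f

  P-symmetric : Symmetric3 P
  P-symmetric = labels-symmetric (edge-symmetric G)

  a : ℕ
  a = f v

  labelling : ℕ → Vtx G v → ℕ
  labelling L (old u _) = f u
  labelling L xv = L
  labelling L yv = L
  labelling L zv = L
  labelling L _ = a

  base-labels : ∀ {L x y z} → BaseEdge G v x y z →
                (P ∪₃ Doubled a L) (labelling L x) (labelling L y) (labelling L z)
  base-labels (oldE x y z e) = inj₁ (x , y , z , e , refl , refl , refl)
  base-labels (linkE u w {e = e}) =
    inj₁ (u , w , v , exchange₂₃ (exchange₁₂ (recompute (T? _) e)) , refl , refl , refl)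
  base-labels (g₁ _ _) = inj₂ apex₁
  base-labels (g₂ _ _) = inj₂ apex₁
  base-labels (g₃ _ _) = inj₂ apex₁
  base-labels (g₄ _ _) = inj₂ apex₁
  base-labels (g₅ _ _) = inj₂ apex₁
  base-labels (g₆ _ _) = inj₂ apex₁

  labels-⊆ : ∀ {L} → labels (EdgeFv G v) (labelling L) ⊆₃ (P ∪₃ Doubled a L)
  labels-⊆ {L} (_ , _ , _ , (_ , _ , _ , be , σ) , refl , refl , refl) =
    resp-↭ (∪-symmetric P-symmetric doubled-symmetric) (map⁺ (labelling L) σ) (base-labels be)

  SharedPair : Set
  SharedPair = ∃ λ x → ∃ λ y → ∃ λ z → Edge G x y z × f x ≡ a × f y ≡ a

  shared? : Dec SharedPair
  shared? = FP.any? λ x → FP.any? λ y → FP.any? λ z →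
              T? (E G x y z) ×-dec (f x ≟ a) ×-dec (f y ≟ a)

  B : ℕ
  B = max 0 (tabulate f)

  f≤B : ∀ u → f u ≤ B
  f≤B u = All.lookup (xs≤max 0 (tabulate f)) (∈-tabulate⁺ u)

  apex : Dec SharedPair → ℕ
  apex (yes (_ , _ , z , _)) = f z
  apex (no _) = suc B

  extended-layered : (d : Dec SharedPair) → LayeredTriples (P ∪₃ Doubled a (apex d))
  extended-layered (yes (x , y , z , e , fx≡a , fy≡a)) =
    antimono [ id , doubled-⊆ P-symmetric shared ]′ LF
    where shared = x , y , z , e , fx≡a , fy≡a , refl
  extended-layered (no ¬shared) =
    ∪-layered LF (doubled-layered (s≤s (f≤B v))) maxes-differ no-common-pair
    where
    below : ∀ {p q r} → P p q r → p < suc B × q < suc B × r < suc B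
    below (x , y , z , _ , refl , refl , refl) = s≤s (f≤B x) , s≤s (f≤B y) , s≤s (f≤B z)

    maxes-differ : ∀ {p q r p′ q′ r′} → P p q r → Doubled a (suc B) p′ q′ r′ →
                   p ⊔ q ⊔ r ≢ p′ ⊔ q′ ⊔ r′
    maxes-differ s d eq with p< , q< , r< ← below s =
      <⇒≱ (⊔-lub (⊔-lub p< q<) r<) (subst (suc B ≤_) (sym eq) (doubled-max d))

    no-common-pair : ∀ {p q r r′} → P p q r → Doubled a (suc B) p q r′ → ⊥
    no-common-pair s apex₁ = <-irrefl refl (proj₁ (below s))
    no-common-pair s apex₂ = <-irrefl refl (proj₁ (proj₂ (below s)))
    no-common-pair (x , y , z , e , fx≡a , fy≡a , _) apex₃ = ¬shared (x , y , z , e , fx≡a , fy≡a)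

  layered-Fv : ∃ λ g → LayeredTriples (labels (EdgeFv G v) g)
  layered-Fv = labelling (apex shared?) , antimono labels-⊆ (extended-layered shared?)

module Backward (G : ThreeGraph) (v : Fin (n G)) {g : Vtx G v → ℕ}
                (LFv : LayeredTriples (labels (EdgeFv G v) g)) where
  open Symmetric3 (edge-symmetric G) renaming (exchange₁₂ to e₁₂; exchange₂₃ to e₂₃)

  S : Triples
  S = labels (EdgeFv G v) g

  S-symmetric : Symmetric3 S
  S-symmetric = labels-symmetric (edgeFv-symmetric G v)

  open Symmetric3 S-symmetric
  open FanoMinusLine LFv S-symmetric

  base : ∀ {x y z} → BaseEdge G v x y z → S (g x) (g y) (g z)
  base be = _ , _ , _ , (_ , _ , _ , be , ↭-refl) , refl , refl , refl

  vn-doubled : ∀ u w .(l : u F.< w) .(e : Edge G v u w) →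
               S (g xv) (g (vn u w l e)) (g (vn u w l e))
  vn-doubled u w l e = subst (S _ _) (sym V≡x) (base (g₁ u w))
    where
    V≡x = proj₁ (fano (base (g₁ u w) , base (g₂ u w) , base (g₃ u w) ,
                       base (g₄ u w) , base (g₅ u w) , base (g₆ u w)))

  LinkEdge : Set
  LinkEdge = ∃ λ u → ∃ λ w → u F.< w × Edge G v u w

  link? : Dec LinkEdge
  link? = FP.any? λ u → FP.any? λ w → (u FP.<? w) ×-dec T? (E G v u w)

  -- the label of v; when v has empty link any value would do
  linkLabel : Dec LinkEdge → ℕ
  linkLabel (yes (u , w , l , e)) = g (vn u w l e)
  linkLabel (no _) = 0

  linkLabel-vn : ∀ u w (l : u F.< w) (e : Edge G v u w) → linkLabel link? ≡ g (vn u w l e)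
  linkLabel-vn u w l e with link?
  ... | yes (u′ , w′ , l′ , e′) = doubled-unique (vn-doubled u′ w′ l′ e′) (vn-doubled u w l e)
  ... | no ¬link = contradiction (u , w , l , e) ¬link

  label : ∀ {u} → Dec (u ≡ v) → ℕ
  label (yes _) = linkLabel link?
  label {u} (no u≢v) = g (old u u≢v)

  f : Fin (n G) → ℕ
  f u = label (u F.≟ v)

  ordered-link-labels : ∀ {y z} (e : Edge G v y z) (y≢v : y ≢ v) (z≢v : z ≢ v) → y F.< z →
                        S (linkLabel link?) (g (old y y≢v)) (g (old z z≢v))
  ordered-link-labels {y} {z} e y≢v z≢v y<z =
    subst (λ c → S c _ _) (sym (linkLabel-vn y z y<z e))
          (exchange₁₂ (exchange₂₃ (base (linkE y z {y≢v} {z≢v} {y<z} {e}))))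

  link-labels : ∀ {y z} (e : Edge G v y z) (y≢v : y ≢ v) (z≢v : z ≢ v) →
                S (linkLabel link?) (g (old y y≢v)) (g (old z z≢v))
  link-labels {y} {z} e y≢v z≢v with FP.<-cmp y z
  ... | tri< y<z _ _ = ordered-link-labels e y≢v z≢v y<z
  ... | tri≈ _ refl _ = ⊥-elim (distinct G y y v (e₂₃ (e₁₂ e)) refl)
  ... | tri> _ _ z<y = exchange₂₃ (ordered-link-labels (e₂₃ e) z≢v y≢v z<y)

  edge-labels : ∀ {x y z} → Edge G x y z →
                (dx : Dec (x ≡ v)) (dy : Dec (y ≡ v)) (dz : Dec (z ≡ v)) →
                S (label dx) (label dy) (label dz)
  edge-labels e (yes refl) (yes refl) _ = ⊥-elim (distinct G v v _ e refl)
  edge-labels e (yes refl) (no _) (yes refl) = ⊥-elim (distinct G v v _ (e₂₃ e) refl)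
  edge-labels e (no _) (yes refl) (yes refl) = ⊥-elim (distinct G v v _ (e₂₃ (e₁₂ e)) refl)
  edge-labels e (yes refl) (no y≢v) (no z≢v) = link-labels e y≢v z≢v
  edge-labels e (no x≢v) (yes refl) (no z≢v) = exchange₁₂ (link-labels (e₁₂ e) x≢v z≢v)
  edge-labels e (no x≢v) (no y≢v) (yes refl) =
    exchange₂₃ (exchange₁₂ (link-labels (e₁₂ (e₂₃ e)) x≢v y≢v))
  edge-labels e (no x≢v) (no y≢v) (no z≢v) = base (oldE _ _ _ {x≢v} {y≢v} {z≢v} e)

  layered-F : ∃ λ f → LayeredTriples (labels (Edge G) f)
  layered-F = f , antimono (λ { (x , y , z , e , refl , refl , refl) →
                                edge-labels e (x F.≟ v) (y F.≟ v) (z F.≟ v) }) LFv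

proposition4p2 : (G : ThreeGraph) (v : Fin (n G)) →
    Layered (Fin (n G)) (Edge G) ⇔ Layered (Vtx G v) (EdgeFv G v)
proposition4p2 G v = mk⇔
  (layeredLabels⇒layered ∘ Forward.layered-Fv G v ∘ proj₂ ∘ layered⇒layeredLabels)
  (layeredLabels⇒layered ∘ Backward.layered-F G v ∘ proj₂ ∘ layered⇒layeredLabels)
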